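{- Let $n\ge 2$. For $k\ge0$ let $t_{n,k}$ be the number of strongly increasing Schröder trees with $n$ leaves and $k$ internal nodes. Then \[ \sum_{k=0}^{n-1} t_{n,k}\, u^k = u \prod_{\ell=2}^{n-1} (1+\ell u). \]
   Context: A Schröder tree is a rooted plane tree (children of each node are ordered) in which every internal node has at least two children; its size is its number of leaves. A strongly increasing Schröder tree is a Schröder tree whose internal nodes carry labels such that, if there are $\ell$ internal nodes, the labels are exactly $1,\dots,\ell$, each used once, and labels strictly increase along every path from the root to a leaf. Leaves are unlabeled. -}

module Defs where

open import Data.Nat using (ℕ; zero; suc; _+_; _*_; _∸_; _≤_; _<_)
open import Data.List using (List; []; _∷_; _++_; length; map; upTo; foldr)
open import Data.List.Relation.Unary.Unique.Propositional using (Unique)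
open import Data.List.Membership.Propositional using (_∈_)
open import Data.List.Relation.Binary.Permutation.Propositional using (_↭_)
open import Data.Product using (Σ; _×_)
open import Data.Unit using (⊤)
open import Relation.Binary.PropositionalEquality using (_≡_)
open import Function.Bundles using (_⇔_)

data STree : Set where
  leaf : STree
  node : ℕ → List STree → STree

mutual
  leaves : STree → ℕ
  leaves leaf = 1
  leaves (node _ ts) = leavesL ts

  leavesL : List STree → ℕ
  leavesL [] = 0
  leavesL (t ∷ ts) = leaves t + leavesL ts

mutual
  labels : STree → List ℕ
  labels leaf = []
  labels (node a ts) = a ∷ labelsL ts

  labelsL : List STree → List ℕ
  labelsL [] = []
  labelsL (t ∷ ts) = labels t ++ labelsL ts

internalNodes : STree → ℕ
internalNodes t = length (labels t)

mutual
  Schroder : STree → Set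
  Schroder leaf = ⊤
  Schroder (node _ ts) = (2 ≤ length ts) × AllSchroder ts

  AllSchroder : List STree → Set
  AllSchroder [] = ⊤
  AllSchroder (t ∷ ts) = Schroder t × AllSchroder ts

ChildAbove : ℕ → STree → Set
ChildAbove a leaf = ⊤
ChildAbove a (node b _) = a < b

mutual
  Increasing : STree → Set
  Increasing leaf = ⊤
  Increasing (node a ts) = AllIncr a ts

  AllIncr : ℕ → List STree → Set
  AllIncr a [] = ⊤
  AllIncr a (t ∷ ts) = ChildAbove a t × Increasing t × AllIncr a ts

oneTo : ℕ → List ℕ
oneTo m = map suc (upTo m)

StronglyIncreasingSchroder : STree → Set
StronglyIncreasingSchroder t =
  Schroder t × Increasing t × (labels t ↭ oneTo (internalNodes t))

SIST : ℕ → ℕ → STree → Set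
SIST n k t = StronglyIncreasingSchroder t × leaves t ≡ n × internalNodes t ≡ k

-- "the number of trees satisfying P is c": an explicit duplicate-free list
-- enumerating exactly the trees satisfying P, of length c.
HasCount : (STree → Set) → ℕ → Set
HasCount P c =
  Σ (List STree) λ L → Unique L × ((t : STree) → (t ∈ L) ⇔ P t) × length L ≡ c

-- Polynomials in u with ℕ coefficients, as coefficient lists (constant first).
Poly : Set
Poly = List ℕ

coeff : Poly → ℕ → ℕ
coeff [] _ = 0
coeff (a ∷ p) zero = a
coeff (a ∷ p) (suc k) = coeff p k

_+ₚ_ : Poly → Poly → Poly
[] +ₚ q = q
(a ∷ p) +ₚ [] = a ∷ p
(a ∷ p) +ₚ (b ∷ q) = (a + b) ∷ (p +ₚ q)

_*ₚ_ : Poly → Poly → Poly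
[] *ₚ q = []
(a ∷ p) *ₚ q = map (a *_) q +ₚ (0 ∷ (p *ₚ q))

prodₚ : List Poly → Poly
prodₚ = foldr _*ₚ_ (1 ∷ [])

uₚ : Poly
uₚ = 0 ∷ 1 ∷ []

onePlus : ℕ → Poly
onePlus ℓ = 1 ∷ ℓ ∷ []

-- [2, 3, ..., n-1]
twoTo : ℕ → List ℕ
twoTo n = map (2 +_) (upTo (n ∸ 2))

rhs : ℕ → Poly
rhs n = uₚ *ₚ prodₚ (map onePlus (twoTo n))

module Submission where

-- In such a tree with k ≥ 1 internal nodes, the node
-- labelled k (the maximal label) has only leaves as children.  Either it has
-- exactly two of them — contracting this "cherry" to a leaf leaves a tree with
-- n-1 leaves and labels 1..k-1, and conversely a cherry labelled k can be
-- grafted onto any of the n-1 leaves of such a tree — or it has at least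
-- three, and deleting one of them leaves a tree with n-1 leaves and the same
-- labels.  Hence t(n+1, k+1) = t(n, k+1) + n · t(n, k), which is also the
-- recursion for the coefficients of u ∏_{ℓ=2}^{n-1} (1+ℓu): the coefficient of
-- u^{k+1} is the elementary symmetric function e_k(2, …, n-1).

open import Defs
open import Data.Nat using (ℕ; zero; suc; _+_; _*_; _∸_; _≤_; _<_; z≤n; s≤s; _≟_; _<?_)
open import Data.Nat.Properties
open import Data.List using (List; []; _∷_; _++_; length; map; upTo; filter; drop)
open import Data.List.Properties
  using (length-++; length-map; map-++; upTo-∷ʳ; length-upTo; filter-++; filter-none; filter-accept; filter-reject; ++-conicalˡ; ++-conicalʳ; ∷-injective)
open import Data.List.Relation.Unary.All as All using (All; []; _∷_)
import Data.List.Relation.Unary.All.Properties as All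
open import Data.List.Relation.Unary.Any using (here; there)
open import Data.List.Relation.Binary.Permutation.Propositional using (_↭_; ↭-refl; ↭-sym; ↭-trans; prep; swap)
open import Data.List.Relation.Binary.Permutation.Propositional.Properties
  using (↭-length; filter-↭; ++⁺ˡ; ++⁺ʳ; shift; drop-∷; ∷↭∷ʳ; All-resp-↭)
open import Data.List.Relation.Unary.Unique.Propositional using (Unique)
open import Data.List.Relation.Unary.AllPairs using ([]; _∷_)
import Data.List.Relation.Unary.Unique.Propositional.Properties as Unique
open import Data.List.Membership.Propositional using (_∈_)
open import Data.List.Membership.Propositional.Properties using (∈-map⁺; ∈-map⁻; ∈-++⁺ˡ; ∈-++⁺ʳ; ∈-++⁻)
open import Data.Product using (Σ; _×_; _,_; proj₁; proj₂)
open import Data.Sum using (_⊎_; inj₁; inj₂)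
open import Data.Unit using (tt)
open import Data.Empty using (⊥; ⊥-elim)
open import Relation.Nullary using (yes; no; ¬_; Dec)
open import Relation.Binary.PropositionalEquality
open import Function.Bundles using (mk⇔)
open import Data.Nat.Solver using (module +-*-Solver)
open +-*-Solver using (solve; _:+_; _:*_; _:=_; con)

++-singleton : ∀ {A : Set} (xs ys : List A) {z : A} → xs ++ ys ≡ z ∷ [] →
               (xs ≡ [] × ys ≡ z ∷ []) ⊎ (xs ≡ z ∷ [] × ys ≡ [])
++-singleton [] ys e = inj₁ (refl , e)
++-singleton (x ∷ xs) ys e with ∷-injective e
... | refl , rest = inj₂ (cong (x ∷_) (++-conicalˡ xs ys rest) , ++-conicalʳ xs ys rest)

length≡0 : ∀ {A : Set} (xs : List A) → length xs ≡ 0 → xs ≡ []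
length≡0 [] _ = refl

length≡1 : ∀ {A : Set} (xs : List A) → length xs ≡ 1 → Σ A λ x → xs ≡ x ∷ []
length≡1 (x ∷ []) _ = x , refl

index-shift : ∀ {i m} n → ¬ i < m → i < m + n → i ∸ m < n
index-shift {i} {m} n i≮m i<m+n =
  subst (i ∸ m <_) (m+n∸m≡n m n) (∸-monoˡ-< i<m+n (≮⇒≥ i≮m))

map-Unique : ∀ {A B : Set} (f : A → B) {L : List A} → Unique L →
             (∀ {x y} → x ∈ L → y ∈ L → f x ≡ f y → x ≡ y) → Unique (map f L)
map-Unique f [] _ = []
map-Unique f {x ∷ xs} (x∉xs ∷ u) inj =
  All.tabulate distinct ∷ map-Unique f u (λ p q → inj (there p) (there q))
  where
    distinct : ∀ {y} → y ∈ map f xs → ¬ f x ≡ y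
    distinct y∈ e with ∈-map⁻ f y∈
    ... | z , z∈xs , refl = All.lookup x∉xs z∈xs (inj (here refl) (there z∈xs) e)

table : ∀ {A B : Set} → (ℕ → A → B) → ℕ → List A → List B
table g zero L = []
table g (suc I) L = table g I L ++ map (g I) L

module _ {A B : Set} (g : ℕ → A → B) where

  ∈-table⁺ : ∀ I L {i x} → i < I → x ∈ L → g i x ∈ table g I L
  ∈-table⁺ (suc I) L {i} i<1+I x∈L with i ≟ I
  ... | yes refl = ∈-++⁺ʳ (table g I L) (∈-map⁺ (g i) x∈L)
  ... | no i≢I = ∈-++⁺ˡ (∈-table⁺ I L (≤∧≢⇒< (≤-pred i<1+I) i≢I) x∈L)

  ∈-table⁻ : ∀ I L {y} → y ∈ table g I L →
             Σ ℕ λ i → i < I × Σ A λ x → x ∈ L × y ≡ g i x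
  ∈-table⁻ (suc I) L y∈ with ∈-++⁻ (table g I L) y∈
  ... | inj₁ p with ∈-table⁻ I L p
  ...   | i , i<I , x , x∈L , e = i , m≤n⇒m≤1+n i<I , x , x∈L , e
  ∈-table⁻ (suc I) L y∈ | inj₂ p with ∈-map⁻ (g I) p
  ...   | x , x∈L , e = I , ≤-refl , x , x∈L , e

  length-table : ∀ I L → length (table g I L) ≡ I * length L
  length-table zero L = refl
  length-table (suc I) L = begin
    length (table g I L ++ map (g I) L)          ≡⟨ length-++ (table g I L) ⟩
    length (table g I L) + length (map (g I) L)  ≡⟨ cong₂ _+_ (length-table I L) (length-map (g I) L) ⟩
    I * length L + length L                      ≡⟨ +-comm (I * length L) (length L) ⟩
    suc I * length L                             ∎
    where open ≡-Reasoning

  table-Unique : ∀ I L → Unique L →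
    (∀ {i j x y} → i < I → j < I → x ∈ L → y ∈ L → g i x ≡ g j y → i ≡ j × x ≡ y) →
    Unique (table g I L)
  table-Unique zero L u inj = []
  table-Unique (suc I) L u inj =
    Unique.++⁺ (table-Unique I L u (λ i< j< → inj (m≤n⇒m≤1+n i<) (m≤n⇒m≤1+n j<)))
               (map-Unique (g I) u (λ x∈ y∈ e → proj₂ (inj ≤-refl ≤-refl x∈ y∈ e)))
               disjoint
    where
      disjoint : ∀ {y} → ¬ (y ∈ table g I L × y ∈ map (g I) L)
      disjoint (p , q) with ∈-table⁻ I L p | ∈-map⁻ (g I) q
      ... | i , i<I , x , x∈L , e₁ | x′ , x′∈L , e₂ =
        <-irrefl (proj₁ (inj (m≤n⇒m≤1+n i<I) ≤-refl x∈L x′∈L (trans (sym e₁) e₂))) i<I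

oneTo-suc : ∀ j → oneTo (suc j) ≡ oneTo j ++ suc j ∷ []
oneTo-suc j = trans (cong (map suc) (sym (upTo-∷ʳ j))) (map-++ suc (upTo j) (j ∷ []))

oneTo-bounded : ∀ j → All (_≤ j) (oneTo j)
oneTo-bounded zero = []
oneTo-bounded (suc j) rewrite oneTo-suc j =
  All.++⁺ (All.map m≤n⇒m≤1+n (oneTo-bounded j)) (≤-refl ∷ [])

length-oneTo : ∀ j → length (oneTo j) ≡ j
length-oneTo j = trans (length-map suc (upTo j)) (length-upTo j)

oneTo-top-↭ : ∀ j → suc j ∷ oneTo j ↭ oneTo (suc j)
oneTo-top-↭ j = subst (suc j ∷ oneTo j ↭_) (sym (oneTo-suc j)) (∷↭∷ʳ (suc j) (oneTo j))

occ : ℕ → List ℕ → ℕ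
occ k xs = length (filter (_≟ k) xs)

occ-++ : ∀ k xs ys → occ k (xs ++ ys) ≡ occ k xs + occ k ys
occ-++ k xs ys = trans (cong length (filter-++ (_≟ k) xs ys)) (length-++ (filter (_≟ k) xs))

occ-↭ : ∀ k {xs ys} → xs ↭ ys → occ k xs ≡ occ k ys
occ-↭ k p = ↭-length (filter-↭ (_≟ k) p)

occ-below : ∀ k {xs} → All (_< k) xs → occ k xs ≡ 0
occ-below k below = cong length (filter-none (_≟ k) (All.map <⇒≢ below))

occ-top : ∀ j → occ (suc j) (oneTo (suc j)) ≡ 1
occ-top j = begin
  occ (suc j) (oneTo (suc j))                       ≡⟨ cong (occ (suc j)) (oneTo-suc j) ⟩
  occ (suc j) (oneTo j ++ suc j ∷ [])               ≡⟨ occ-++ (suc j) (oneTo j) (suc j ∷ []) ⟩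
  occ (suc j) (oneTo j) + occ (suc j) (suc j ∷ [])  ≡⟨ cong₂ _+_ below top ⟩
  1                                                 ∎
  where
    open ≡-Reasoning
    below : occ (suc j) (oneTo j) ≡ 0
    below = occ-below (suc j) (All.map s≤s (oneTo-bounded j))
    top : occ (suc j) (suc j ∷ []) ≡ 1
    top = cong length (filter-accept (_≟ suc j) refl)

occ-here : ∀ {k a} xs → a ≡ k → occ k (a ∷ xs) ≡ suc (occ k xs)
occ-here {k} xs a≡k = cong length (filter-accept (_≟ k) a≡k)

occ-there : ∀ {k a} xs → ¬ a ≡ k → occ k (a ∷ xs) ≡ occ k xs
occ-there {k} xs a≢k = cong length (filter-reject (_≟ k) a≢k)

-- case distinction on a decision; used instead of 'with' in the tree
-- operations below, so that one case split on 'a ≟ k' in a proof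
-- evaluates every operation at that node simultaneously
ifDec : ∀ {A P : Set} → Dec P → A → A → A
ifDec (yes _) x y = x
ifDec (no _) x y = y

mutual
  childLists : ℕ → STree → List (List STree)
  childLists k leaf = []
  childLists k (node a ts) = ifDec (a ≟ k) (ts ∷ childListsL k ts) (childListsL k ts)

  childListsL : ℕ → List STree → List (List STree)
  childListsL k [] = []
  childListsL k (t ∷ ts) = childLists k t ++ childListsL k ts

mutual
  length-childLists : ∀ k t → length (childLists k t) ≡ occ k (labels t)
  length-childLists k leaf = refl
  length-childLists k (node a ts) with a ≟ k
  ... | yes a≡k = trans (cong suc (length-childListsL k ts)) (sym (occ-here (labelsL ts) a≡k))
  ... | no a≢k = trans (length-childListsL k ts) (sym (occ-there (labelsL ts) a≢k))

  length-childListsL : ∀ k ts → length (childListsL k ts) ≡ occ k (labelsL ts)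
  length-childListsL k [] = refl
  length-childListsL k (t ∷ ts) = begin
    length (childLists k t ++ childListsL k ts)          ≡⟨ length-++ (childLists k t) ⟩
    length (childLists k t) + length (childListsL k ts)  ≡⟨ cong₂ _+_ (length-childLists k t) (length-childListsL k ts) ⟩
    occ k (labels t) + occ k (labelsL ts)                ≡⟨ sym (occ-++ k (labels t) (labelsL ts)) ⟩
    occ k (labelsL (t ∷ ts))                             ∎
    where open ≡-Reasoning

Absent : ℕ → STree → Set
Absent k t = childLists k t ≡ []

SoleNode : ℕ → STree → List STree → Set
SoleNode k t us = childLists k t ≡ us ∷ []

soleNode-∷ : ∀ k t ts {us} → childListsL k (t ∷ ts) ≡ us ∷ [] →
             (Absent k t × childListsL k ts ≡ us ∷ []) ⊎ (SoleNode k t us × childListsL k ts ≡ [])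
soleNode-∷ k t ts = ++-singleton (childLists k t) (childListsL k ts)

absent-∷ : ∀ k t ts → childListsL k (t ∷ ts) ≡ [] → Absent k t × childListsL k ts ≡ []
absent-∷ k t ts e = ++-conicalˡ (childLists k t) _ e , ++-conicalʳ (childLists k t) _ e

mutual
  schroder-childLists : ∀ k t → Schroder t → All (λ ts → 2 ≤ length ts) (childLists k t)
  schroder-childLists k leaf _ = []
  schroder-childLists k (node a ts) (l , ss) with a ≟ k
  ... | yes _ = l ∷ schroder-childListsL k ts ss
  ... | no _ = schroder-childListsL k ts ss

  schroder-childListsL : ∀ k ts → AllSchroder ts → All (λ us → 2 ≤ length us) (childListsL k ts)
  schroder-childListsL k [] _ = []
  schroder-childListsL k (t ∷ ts) (s , ss) =
    All.++⁺ (schroder-childLists k t s) (schroder-childListsL k ts ss)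

onlyLeaves : ∀ {k} ts → AllIncr k ts → All (_≤ k) (labelsL ts) → All (_≡ leaf) ts
onlyLeaves [] _ _ = []
onlyLeaves (leaf ∷ ts) (_ , _ , incs) bounded = refl ∷ onlyLeaves ts incs bounded
onlyLeaves (node b _ ∷ _) (k<b , _) (b≤k ∷ _) = ⊥-elim (<-irrefl refl (<-≤-trans k<b b≤k))

mutual
  maximal-childLists : ∀ k t → Increasing t → All (_≤ k) (labels t) →
                       All (All (_≡ leaf)) (childLists k t)
  maximal-childLists k leaf _ _ = []
  maximal-childLists k (node a ts) inc (_ ∷ bounded) with a ≟ k
  ... | yes refl = onlyLeaves ts inc bounded ∷ maximal-childListsL k a ts inc bounded
  ... | no _ = maximal-childListsL k a ts inc bounded

  maximal-childListsL : ∀ k a ts → AllIncr a ts → All (_≤ k) (labelsL ts) →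
                        All (All (_≡ leaf)) (childListsL k ts)
  maximal-childListsL k a [] _ _ = []
  maximal-childListsL k a (t ∷ ts) (_ , inc , incs) bounded =
    All.++⁺ (maximal-childLists k t inc (All.++⁻ˡ (labels t) bounded))
            (maximal-childListsL k a ts incs (All.++⁻ʳ (labels t) bounded))

mutual
  -- modifyAt k f t applies f to the child list of each node labelled k
  -- (without descending further into that node)
  modifyAt : ℕ → (List STree → List STree) → STree → STree
  modifyAt k f leaf = leaf
  modifyAt k f (node a ts) = node a (ifDec (a ≟ k) (f ts) (modifyAtL k f ts))

  modifyAtL : ℕ → (List STree → List STree) → List STree → List STree
  modifyAtL k f [] = []
  modifyAtL k f (t ∷ ts) = modifyAt k f t ∷ modifyAtL k f ts

addLeaf removeLeaf : ℕ → STree → STree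
addLeaf k = modifyAt k (leaf ∷_)
removeLeaf k = modifyAt k (drop 1)

mutual
  modifyAt-absent : ∀ k f t → Absent k t → modifyAt k f t ≡ t
  modifyAt-absent k f leaf _ = refl
  modifyAt-absent k f (node a ts) none with a ≟ k
  modifyAt-absent k f (node a ts) () | yes _
  ... | no _ = cong (node a) (modifyAtL-absent k f ts none)

  modifyAtL-absent : ∀ k f ts → childListsL k ts ≡ [] → modifyAtL k f ts ≡ ts
  modifyAtL-absent k f [] _ = refl
  modifyAtL-absent k f (t ∷ ts) none with absent-∷ k t ts none
  ... | none₁ , none₂ = cong₂ _∷_ (modifyAt-absent k f t none₁) (modifyAtL-absent k f ts none₂)

mutual
  modifyAt-inverse : ∀ k f g t → All (λ ts → g (f ts) ≡ ts) (childLists k t) →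
                     modifyAt k g (modifyAt k f t) ≡ t
  modifyAt-inverse k f g leaf _ = refl
  modifyAt-inverse k f g (node a ts) gf with a ≟ k
  ... | yes _ = cong (node a) (All.head gf)
  ... | no _ = cong (node a) (modifyAtL-inverse k f g ts gf)

  modifyAtL-inverse : ∀ k f g ts → All (λ us → g (f us) ≡ us) (childListsL k ts) →
                      modifyAtL k g (modifyAtL k f ts) ≡ ts
  modifyAtL-inverse k f g [] _ = refl
  modifyAtL-inverse k f g (t ∷ ts) gf =
    cong₂ _∷_ (modifyAt-inverse k f g t (All.++⁻ˡ (childLists k t) gf))
              (modifyAtL-inverse k f g ts (All.++⁻ʳ (childLists k t) gf))

mutual
  labels-modifyAt : ∀ k f → (∀ ts → labelsL (f ts) ≡ labelsL ts) →
                    ∀ t → labels (modifyAt k f t) ≡ labels t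
  labels-modifyAt k f same leaf = refl
  labels-modifyAt k f same (node a ts) with a ≟ k
  ... | yes _ = cong (a ∷_) (same ts)
  ... | no _ = cong (a ∷_) (labelsL-modifyAt k f same ts)

  labelsL-modifyAt : ∀ k f → (∀ ts → labelsL (f ts) ≡ labelsL ts) →
                     ∀ ts → labelsL (modifyAtL k f ts) ≡ labelsL ts
  labelsL-modifyAt k f same [] = refl
  labelsL-modifyAt k f same (t ∷ ts) =
    cong₂ _++_ (labels-modifyAt k f same t) (labelsL-modifyAt k f same ts)

mutual
  leaves-modifyAt : ∀ k f → (∀ ts → leavesL (f ts) ≡ suc (leavesL ts)) →
                    ∀ t {us} → SoleNode k t us → leaves (modifyAt k f t) ≡ suc (leaves t)
  leaves-modifyAt k f grow leaf ()
  leaves-modifyAt k f grow (node a ts) sole with a ≟ k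
  ... | yes _ = grow ts
  ... | no _ = leavesL-modifyAt k f grow ts sole

  leavesL-modifyAt : ∀ k f → (∀ ts → leavesL (f ts) ≡ suc (leavesL ts)) →
                     ∀ ts {us} → childListsL k ts ≡ us ∷ [] → leavesL (modifyAtL k f ts) ≡ suc (leavesL ts)
  leavesL-modifyAt k f grow [] ()
  leavesL-modifyAt k f grow (t ∷ ts) sole with soleNode-∷ k t ts sole
  ... | inj₁ (none , sole′) =
    trans (cong₂ _+_ (cong leaves (modifyAt-absent k f t none)) (leavesL-modifyAt k f grow ts sole′))
          (+-suc (leaves t) (leavesL ts))
  ... | inj₂ (sole′ , none) =
    cong₂ _+_ (leaves-modifyAt k f grow t sole′) (cong leavesL (modifyAtL-absent k f ts none))

mutual
  soleNode-modifyAt : ∀ k f t {us} → childListsL k (f us) ≡ childListsL k us →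
                      SoleNode k t us → SoleNode k (modifyAt k f t) (f us)
  soleNode-modifyAt k f leaf keep ()
  soleNode-modifyAt k f (node a ts) keep sole with a ≟ k
  ... | yes _ with ∷-injective sole
  ...   | refl , none = cong (f ts ∷_) (trans keep none)
  soleNode-modifyAt k f (node a ts) keep sole | no _ = soleNodeL-modifyAt k f ts keep sole

  soleNodeL-modifyAt : ∀ k f ts {us} → childListsL k (f us) ≡ childListsL k us →
                       childListsL k ts ≡ us ∷ [] → childListsL k (modifyAtL k f ts) ≡ f us ∷ []
  soleNodeL-modifyAt k f [] keep ()
  soleNodeL-modifyAt k f (t ∷ ts) keep sole with soleNode-∷ k t ts sole
  ... | inj₁ (none , sole′) rewrite modifyAt-absent k f t none | none =
    soleNodeL-modifyAt k f ts keep sole′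
  ... | inj₂ (sole′ , none) rewrite modifyAtL-absent k f ts none | none =
    cong (_++ []) (soleNode-modifyAt k f t keep sole′)

mutual
  schroder-modifyAt : ∀ k f → (∀ ts → AllSchroder ts → AllSchroder (f ts)) →
    ∀ t → All (λ ts → 2 ≤ length (f ts)) (childLists k t) → Schroder t → Schroder (modifyAt k f t)
  schroder-modifyAt k f keep leaf _ _ = tt
  schroder-modifyAt k f keep (node a ts) wide (l , ss) with a ≟ k
  ... | yes _ = All.head wide , keep ts ss
  ... | no _ = subst (2 ≤_) (sym (length-modifyAtL k f ts)) l , schroderL-modifyAt k f keep ts wide ss

  schroderL-modifyAt : ∀ k f → (∀ ts → AllSchroder ts → AllSchroder (f ts)) →
    ∀ ts → All (λ us → 2 ≤ length (f us)) (childListsL k ts) → AllSchroder ts → AllSchroder (modifyAtL k f ts)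
  schroderL-modifyAt k f keep [] _ _ = tt
  schroderL-modifyAt k f keep (t ∷ ts) wide (s , ss) =
    schroder-modifyAt k f keep t (All.++⁻ˡ (childLists k t) wide) s ,
    schroderL-modifyAt k f keep ts (All.++⁻ʳ (childLists k t) wide) ss

  length-modifyAtL : ∀ k f ts → length (modifyAtL k f ts) ≡ length ts
  length-modifyAtL k f [] = refl
  length-modifyAtL k f (t ∷ ts) = cong suc (length-modifyAtL k f ts)

childAbove-modifyAt : ∀ k f a t → ChildAbove a t → ChildAbove a (modifyAt k f t)
childAbove-modifyAt k f a leaf above = above
childAbove-modifyAt k f a (node b ts) above = above

mutual
  increasing-modifyAt : ∀ k f → (∀ ts → AllIncr k ts → AllIncr k (f ts)) →
                        ∀ t → Increasing t → Increasing (modifyAt k f t)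
  increasing-modifyAt k f keep leaf _ = tt
  increasing-modifyAt k f keep (node a ts) inc with a ≟ k
  ... | yes refl = keep ts inc
  ... | no _ = increasingL-modifyAt k f keep a ts inc

  increasingL-modifyAt : ∀ k f → (∀ ts → AllIncr k ts → AllIncr k (f ts)) →
                         ∀ a ts → AllIncr a ts → AllIncr a (modifyAtL k f ts)
  increasingL-modifyAt k f keep a [] _ = tt
  increasingL-modifyAt k f keep a (t ∷ ts) (above , inc , incs) =
    childAbove-modifyAt k f a t above ,
    increasing-modifyAt k f keep t inc ,
    increasingL-modifyAt k f keep a ts incs

cherryKids : List STree
cherryKids = leaf ∷ leaf ∷ []

mutual
  -- graft k i t replaces the i-th leaf of t (from the left, counting from 0)
  -- by a cherry labelled k
  graft : ℕ → ℕ → STree → STree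
  graft k i (node a ts) = node a (graftL k i ts)
  graft k zero leaf = node k cherryKids
  graft k (suc i) leaf = leaf

  graftL : ℕ → ℕ → List STree → List STree
  graftL k i [] = []
  graftL k i (t ∷ ts) = ifDec (i <? leaves t) (graft k i t ∷ ts) (t ∷ graftL k (i ∸ leaves t) ts)

mutual
  ungraft : ℕ → STree → STree
  ungraft k leaf = leaf
  ungraft k (node a ts) = ifDec (a ≟ k) leaf (node a (ungraftL k ts))

  ungraftL : ℕ → List STree → List STree
  ungraftL k [] = []
  ungraftL k (t ∷ ts) = ungraft k t ∷ ungraftL k ts

graftL-here : ∀ k i t ts → i < leaves t → graftL k i (t ∷ ts) ≡ graft k i t ∷ ts
graftL-here k i t ts i< with i <? leaves t
... | yes _ = refl
... | no i≮ = ⊥-elim (i≮ i<)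

graftL-skip : ∀ k t i ts → graftL k (leaves t + i) (t ∷ ts) ≡ t ∷ graftL k i ts
graftL-skip k t i ts with leaves t + i <? leaves t
... | yes past = ⊥-elim (m+n≮m (leaves t) i past)
... | no _ = cong (λ j → t ∷ graftL k j ts) (m+n∸m≡n (leaves t) i)

mutual
  leaves-graft : ∀ k i t → i < leaves t → leaves (graft k i t) ≡ suc (leaves t)
  leaves-graft k i (node a ts) i< = leavesL-graft k i ts i<
  leaves-graft k zero leaf _ = refl
  leaves-graft k (suc i) leaf (s≤s ())

  leavesL-graft : ∀ k i ts → i < leavesL ts → leavesL (graftL k i ts) ≡ suc (leavesL ts)
  leavesL-graft k i (t ∷ ts) i< with i <? leaves t
  ... | yes i<t = cong (_+ leavesL ts) (leaves-graft k i t i<t)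
  ... | no i≮t = trans (cong (leaves t +_) (leavesL-graft k (i ∸ leaves t) ts (index-shift (leavesL ts) i≮t i<)))
                       (+-suc (leaves t) (leavesL ts))

mutual
  labels-graft : ∀ k i t → i < leaves t → labels (graft k i t) ↭ k ∷ labels t
  labels-graft k i (node a ts) i< = ↭-trans (prep a (labelsL-graft k i ts i<)) (swap a k ↭-refl)
  labels-graft k zero leaf _ = ↭-refl
  labels-graft k (suc i) leaf (s≤s ())

  labelsL-graft : ∀ k i ts → i < leavesL ts → labelsL (graftL k i ts) ↭ k ∷ labelsL ts
  labelsL-graft k i (t ∷ ts) i< with i <? leaves t
  ... | yes i<t = ++⁺ʳ (labelsL ts) (labels-graft k i t i<t)
  ... | no i≮t = ↭-trans (++⁺ˡ (labels t) (labelsL-graft k (i ∸ leaves t) ts (index-shift (leavesL ts) i≮t i<)))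
                         (shift k (labels t) (labelsL ts))

mutual
  schroder-graft : ∀ k i t → Schroder t → Schroder (graft k i t)
  schroder-graft k i (node a ts) (l , ss) = subst (2 ≤_) (sym (length-graftL k i ts)) l , schroderL-graft k i ts ss
  schroder-graft k zero leaf _ = s≤s (s≤s z≤n) , tt , tt , tt
  schroder-graft k (suc i) leaf _ = tt

  schroderL-graft : ∀ k i ts → AllSchroder ts → AllSchroder (graftL k i ts)
  schroderL-graft k i [] _ = tt
  schroderL-graft k i (t ∷ ts) (s , ss) with i <? leaves t
  ... | yes _ = schroder-graft k i t s , ss
  ... | no _ = s , schroderL-graft k (i ∸ leaves t) ts ss

  length-graftL : ∀ k i ts → length (graftL k i ts) ≡ length ts
  length-graftL k i [] = refl
  length-graftL k i (t ∷ ts) with i <? leaves t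
  ... | yes _ = refl
  ... | no _ = cong suc (length-graftL k (i ∸ leaves t) ts)

childAbove-graft : ∀ k i a t → a < k → ChildAbove a t → ChildAbove a (graft k i t)
childAbove-graft k i a (node b ts) _ above = above
childAbove-graft k zero a leaf a<k _ = a<k
childAbove-graft k (suc i) a leaf _ _ = tt

mutual
  increasing-graft : ∀ k i t → Increasing t → All (_< k) (labels t) → Increasing (graft k i t)
  increasing-graft k i (node a ts) inc (a<k ∷ below) = increasingL-graft k i a ts a<k inc below
  increasing-graft k zero leaf _ _ = tt , tt , tt , tt , tt
  increasing-graft k (suc i) leaf _ _ = tt

  increasingL-graft : ∀ k i a ts → a < k → AllIncr a ts → All (_< k) (labelsL ts) → AllIncr a (graftL k i ts)
  increasingL-graft k i a [] _ _ _ = tt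
  increasingL-graft k i a (t ∷ ts) a<k (above , inc , incs) below with i <? leaves t
  ... | yes _ = childAbove-graft k i a t a<k above , increasing-graft k i t inc (All.++⁻ˡ (labels t) below) , incs
  ... | no _ = above , inc , increasingL-graft k (i ∸ leaves t) a ts a<k incs (All.++⁻ʳ (labels t) below)

mutual
  soleNode-graft : ∀ k i t → Absent k t → i < leaves t → SoleNode k (graft k i t) cherryKids
  soleNode-graft k i (node a ts) none i< with a ≟ k
  soleNode-graft k i (node a ts) () i< | yes _
  ... | no _ = soleNodeL-graft k i ts none i<
  soleNode-graft k zero leaf _ _ with k ≟ k
  ... | yes _ = refl
  ... | no k≢k = ⊥-elim (k≢k refl)
  soleNode-graft k (suc i) leaf _ (s≤s ())

  soleNodeL-graft : ∀ k i ts → childListsL k ts ≡ [] → i < leavesL ts → childListsL k (graftL k i ts) ≡ cherryKids ∷ []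
  soleNodeL-graft k i (t ∷ ts) none i< with absent-∷ k t ts none | i <? leaves t
  ... | none₁ , none₂ | yes i<t rewrite soleNode-graft k i t none₁ i<t | none₂ = refl
  ... | none₁ , none₂ | no i≮t rewrite none₁ =
    soleNodeL-graft k (i ∸ leaves t) ts none₂ (index-shift (leavesL ts) i≮t i<)

mutual
  ungraft-absent : ∀ k t → Absent k t → ungraft k t ≡ t
  ungraft-absent k leaf _ = refl
  ungraft-absent k (node a ts) none with a ≟ k
  ungraft-absent k (node a ts) () | yes _
  ... | no _ = cong (node a) (ungraftL-absent k ts none)

  ungraftL-absent : ∀ k ts → childListsL k ts ≡ [] → ungraftL k ts ≡ ts
  ungraftL-absent k [] _ = refl
  ungraftL-absent k (t ∷ ts) none with absent-∷ k t ts none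
  ... | none₁ , none₂ = cong₂ _∷_ (ungraft-absent k t none₁) (ungraftL-absent k ts none₂)

mutual
  ungraft-graft : ∀ k i t → Absent k t → ungraft k (graft k i t) ≡ t
  ungraft-graft k i (node a ts) none with a ≟ k
  ungraft-graft k i (node a ts) () | yes _
  ... | no _ = cong (node a) (ungraftL-graft k i ts none)
  ungraft-graft k zero leaf _ with k ≟ k
  ... | yes _ = refl
  ... | no k≢k = ⊥-elim (k≢k refl)
  ungraft-graft k (suc i) leaf _ = refl

  ungraftL-graft : ∀ k i ts → childListsL k ts ≡ [] → ungraftL k (graftL k i ts) ≡ ts
  ungraftL-graft k i [] _ = refl
  ungraftL-graft k i (t ∷ ts) none with absent-∷ k t ts none | i <? leaves t
  ... | none₁ , none₂ | yes _ = cong₂ _∷_ (ungraft-graft k i t none₁) (ungraftL-absent k ts none₂)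
  ... | none₁ , none₂ | no _ = cong₂ _∷_ (ungraft-absent k t none₁) (ungraftL-graft k (i ∸ leaves t) ts none₂)

mutual
  graft-injective : ∀ k i j t → i < leaves t → j < leaves t → graft k i t ≡ graft k j t → i ≡ j
  graft-injective k i j (node a ts) i< j< e = graftL-injective k i j ts i< j< (cong children e)
    where
      children : STree → List STree
      children leaf = []
      children (node _ us) = us
  graft-injective k zero zero leaf _ _ _ = refl
  graft-injective k (suc i) j leaf (s≤s ()) _ _
  graft-injective k zero (suc j) leaf _ (s≤s ()) _

  graftL-injective : ∀ k i j ts → i < leavesL ts → j < leavesL ts → graftL k i ts ≡ graftL k j ts → i ≡ j
  graftL-injective k i j (t ∷ ts) i< j< e with i <? leaves t | j <? leaves t
  ... | yes i<t | yes j<t = graft-injective k i j t i<t j<t (proj₁ (∷-injective e))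
  ... | yes i<t | no _ =
    ⊥-elim (1+n≢n (trans (sym (leaves-graft k i t i<t)) (cong leaves (proj₁ (∷-injective e)))))
  ... | no _ | yes j<t =
    ⊥-elim (1+n≢n (trans (sym (leaves-graft k j t j<t)) (cong leaves (sym (proj₁ (∷-injective e))))))
  ... | no i≮t | no j≮t =
    ∸-cancelʳ-≡ (≮⇒≥ i≮t) (≮⇒≥ j≮t)
      (graftL-injective k (i ∸ leaves t) (j ∸ leaves t) ts
        (index-shift (leavesL ts) i≮t i<) (index-shift (leavesL ts) j≮t j<) (proj₂ (∷-injective e)))

mutual
  graft-ungraft : ∀ k t → SoleNode k t cherryKids →
                  Σ ℕ λ i → i < leaves (ungraft k t) × graft k i (ungraft k t) ≡ t
  graft-ungraft k (node a ts) sole with a ≟ k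
  ... | yes refl with ∷-injective sole
  ...   | refl , _ = 0 , s≤s z≤n , refl
  graft-ungraft k (node a ts) sole | no _ with graftL-ungraft k ts sole
  ...   | i , i< , e = i , i< , cong (node a) e

  graftL-ungraft : ∀ k ts → childListsL k ts ≡ cherryKids ∷ [] →
                   Σ ℕ λ i → i < leavesL (ungraftL k ts) × graftL k i (ungraftL k ts) ≡ ts
  graftL-ungraft k (t ∷ ts) sole with soleNode-∷ k t ts sole
  ... | inj₁ (none , sole′) rewrite ungraft-absent k t none with graftL-ungraft k ts sole′
  ...   | i , i< , e = leaves t + i , +-monoʳ-< (leaves t) i< ,
                       trans (graftL-skip k t i (ungraftL k ts)) (cong (t ∷_) e)
  graftL-ungraft k (t ∷ ts) sole | inj₂ (sole′ , none) rewrite ungraftL-absent k ts none with graft-ungraft k t sole′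
  ...   | i , i< , e = i , ≤-trans i< (m≤m+n _ _) ,
                       trans (graftL-here k i (ungraft k t) ts i<) (cong (_∷ ts) e)

graft-jointly-injective : ∀ k {i j s s′} → Absent k s → Absent k s′ → i < leaves s → j < leaves s →
                          graft k i s ≡ graft k j s′ → i ≡ j × s ≡ s′
graft-jointly-injective k {i} {j} {s} {s′} none none′ i< j< e = i≡j , s≡s′
  where
    s≡s′ : s ≡ s′
    s≡s′ = trans (sym (ungraft-graft k i s none)) (trans (cong (ungraft k) e) (ungraft-graft k j s′ none′))
    i≡j : i ≡ j
    i≡j = graft-injective k i j s i< j< (trans e (cong (graft k j) (sym s≡s′)))

mutual
  schroder-ungraft : ∀ k t → Schroder t → Schroder (ungraft k t)
  schroder-ungraft k leaf _ = tt
  schroder-ungraft k (node a ts) (l , ss) with a ≟ k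
  ... | yes _ = tt
  ... | no _ = subst (2 ≤_) (sym (length-ungraftL k ts)) l , schroderL-ungraft k ts ss

  schroderL-ungraft : ∀ k ts → AllSchroder ts → AllSchroder (ungraftL k ts)
  schroderL-ungraft k [] _ = tt
  schroderL-ungraft k (t ∷ ts) (s , ss) = schroder-ungraft k t s , schroderL-ungraft k ts ss

  length-ungraftL : ∀ k ts → length (ungraftL k ts) ≡ length ts
  length-ungraftL k [] = refl
  length-ungraftL k (t ∷ ts) = cong suc (length-ungraftL k ts)

-- contracting a node to a leaf can only weaken the constraint on its parent
childAbove-ungraft : ∀ k a t → ChildAbove a t → ChildAbove a (ungraft k t)
childAbove-ungraft k a leaf above = above
childAbove-ungraft k a (node b ts) above with b ≟ k
... | yes _ = tt
... | no _ = above

mutual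
  increasing-ungraft : ∀ k t → Increasing t → Increasing (ungraft k t)
  increasing-ungraft k leaf _ = tt
  increasing-ungraft k (node a ts) inc with a ≟ k
  ... | yes _ = tt
  ... | no _ = increasingL-ungraft k a ts inc

  increasingL-ungraft : ∀ k a ts → AllIncr a ts → AllIncr a (ungraftL k ts)
  increasingL-ungraft k a [] _ = tt
  increasingL-ungraft k a (t ∷ ts) (above , inc , incs) =
    childAbove-ungraft k a t above , increasing-ungraft k t inc , increasingL-ungraft k a ts incs

mutual
  leaves-positive : ∀ t → Schroder t → 1 ≤ leaves t
  leaves-positive leaf _ = s≤s z≤n
  leaves-positive (node a ts) (l , ss) = ≤-trans (≤-trans (s≤s z≤n) l) (length≤leavesL ts ss)

  length≤leavesL : ∀ ts → AllSchroder ts → length ts ≤ leavesL ts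
  length≤leavesL [] _ = z≤n
  length≤leavesL (t ∷ ts) (s , ss) = +-mono-≤ (leaves-positive t s) (length≤leavesL ts ss)

single-leaf : ∀ t → Schroder t → leaves t ≤ 1 → t ≡ leaf
single-leaf leaf _ _ = refl
single-leaf (node a ts) (l , ss) ≤1 = ⊥-elim (1+n≰n (≤-trans (≤-trans l (length≤leavesL ts ss)) ≤1))

sist-labels : ∀ {n k t} → SIST n k t → labels t ↭ oneTo k
sist-labels ((_ , _ , π) , _ , refl) = π

sist-bounded : ∀ {n k t} → SIST n k t → All (_≤ k) (labels t)
sist-bounded σ = All-resp-↭ (↭-sym (sist-labels σ)) (oneTo-bounded _)

sist-fresh : ∀ {n j t} → SIST n j t → Absent (suc j) t
sist-fresh {j = j} {t} σ =
  length≡0 (childLists (suc j) t)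
    (trans (length-childLists (suc j) t) (occ-below (suc j) (All.map s≤s (sist-bounded σ))))

maximal-node : ∀ {n j t} → SIST n (suc j) t →
  Σ (List STree) λ us → SoleNode (suc j) t us × All (_≡ leaf) us × 2 ≤ length us
maximal-node {j = j} {t} σ@((S , I , _) , _ , _)
  with length≡1 (childLists (suc j) t)
         (trans (length-childLists (suc j) t) (trans (occ-↭ (suc j) (sist-labels σ)) (occ-top j)))
... | us , sole =
  us , sole ,
  All.head (subst (All _) sole (maximal-childLists (suc j) t I (sist-bounded σ))) ,
  All.head (subst (All _) sole (schroder-childLists (suc j) t S))

-- the number of internal nodes is determined by the label list
mkSIST : ∀ {n k} t → Schroder t → Increasing t → labels t ↭ oneTo k → leaves t ≡ n → SIST n k t
mkSIST t S I π lv = (S , I , subst (λ z → labels t ↭ oneTo z) (sym size) π) , lv , size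
  where size = trans (↭-length π) (length-oneTo _)

drop1-AllSchroder : ∀ ts → AllSchroder ts → AllSchroder (drop 1 ts)
drop1-AllSchroder [] _ = tt
drop1-AllSchroder (_ ∷ _) (_ , ss) = ss

drop1-AllIncr : ∀ a ts → AllIncr a ts → AllIncr a (drop 1 ts)
drop1-AllIncr a [] _ = tt
drop1-AllIncr a (_ ∷ _) (_ , _ , incs) = incs

removeLeaf-addLeaf : ∀ k s → removeLeaf k (addLeaf k s) ≡ s
removeLeaf-addLeaf k s = modifyAt-inverse k (leaf ∷_) (drop 1) s (All.tabulate (λ _ → refl))

addLeaf-SIST : ∀ {n j s} → SIST n (suc j) s → SIST (suc n) (suc j) (addLeaf (suc j) s)
addLeaf-SIST {j = j} {s} σ@((S , I , _) , refl , _) with maximal-node σ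
... | _ , sole , _ , _ =
  mkSIST (addLeaf k s)
    (schroder-modifyAt k (leaf ∷_) (λ _ ss → tt , ss) s (All.map m≤n⇒m≤1+n (schroder-childLists k s S)) S)
    (increasing-modifyAt k (leaf ∷_) (λ _ incs → tt , tt , incs) s I)
    (subst (_↭ oneTo k) (sym (labels-modifyAt k (leaf ∷_) (λ _ → refl) s)) (sist-labels σ))
    (leaves-modifyAt k (leaf ∷_) (λ _ → refl) s sole)
  where k = suc j

graft-SIST : ∀ {n j s} i → i < n → SIST n j s → SIST (suc n) (suc j) (graft (suc j) i s)
graft-SIST {j = j} {s} i i< σ@((S , I , _) , refl , _) =
  mkSIST (graft k i s)
    (schroder-graft k i s S)
    (increasing-graft k i s I (All.map s≤s (sist-bounded σ)))
    (↭-trans (labels-graft k i s i<) (↭-trans (prep k (sist-labels σ)) (oneTo-top-↭ j)))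
    (leaves-graft k i s i<)
  where k = suc j

removeLeaf-SIST : ∀ {n k t us} → SIST (suc n) k t → SoleNode k t (leaf ∷ us) → 2 ≤ length us →
                  SIST n k (removeLeaf k t) × addLeaf k (removeLeaf k t) ≡ t
removeLeaf-SIST {n} {k} {t} {us} σ@((S , I , _) , lv , _) sole two =
  mkSIST s
    (schroder-modifyAt k (drop 1) drop1-AllSchroder t (subst (All _) (sym sole) (two ∷ [])) S)
    (increasing-modifyAt k (drop 1) (drop1-AllIncr k) t I)
    (subst (_↭ oneTo k) (sym sameLabels) (sist-labels σ))
    (suc-injective (trans (sym (leaves-modifyAt k (leaf ∷_) (λ _ → refl) s soleAfter))
                          (trans (cong leaves restore) lv)))
  , restore
  where
    s = removeLeaf k t
    restore : addLeaf k s ≡ t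
    restore = modifyAt-inverse k (drop 1) (leaf ∷_) t (subst (All _) (sym sole) (refl ∷ []))
    sameLabels : labels s ≡ labels t
    sameLabels = trans (sym (labels-modifyAt k (leaf ∷_) (λ _ → refl) s)) (cong labels restore)
    soleAfter : SoleNode k s us
    soleAfter = soleNode-modifyAt k (drop 1) t refl sole

ungraft-SIST : ∀ {n j t} → SIST (suc n) (suc j) t → SoleNode (suc j) t cherryKids →
  Σ ℕ λ i → i < n × SIST n j (ungraft (suc j) t) × graft (suc j) i (ungraft (suc j) t) ≡ t
ungraft-SIST {n} {j} {t} σ@((S , I , _) , lv , _) sole with graft-ungraft (suc j) t sole
... | i , i< , restore =
  i , subst (i <_) fewer i< ,
  mkSIST s (schroder-ungraft k t S) (increasing-ungraft k t I) remaining fewer ,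
  restore
  where
    k = suc j
    s = ungraft k t
    fewer : leaves s ≡ n
    fewer = suc-injective (trans (sym (leaves-graft k i s i<)) (trans (cong leaves restore) lv))
    remaining : labels s ↭ oneTo j
    remaining = drop-∷ (↭-trans (↭-sym (labels-graft k i s i<))
                 (↭-trans (subst (λ x → labels x ↭ oneTo k) (sym restore) (sist-labels σ))
                          (↭-sym (oneTo-top-↭ j))))

decompose : ∀ {n j t} → SIST (suc n) (suc j) t →
  (Σ STree λ s → SIST n (suc j) s × addLeaf (suc j) s ≡ t) ⊎
  (Σ ℕ λ i → i < n × Σ STree λ s → SIST n j s × graft (suc j) i s ≡ t)
decompose σ with maximal-node σ
... | (_ ∷ _ ∷ []) , sole , refl ∷ refl ∷ [] , _ with ungraft-SIST σ sole
...   | i , i< , σ′ , restore = inj₂ (i , i< , _ , σ′ , restore)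
decompose σ | (_ ∷ _ ∷ _ ∷ _) , sole , refl ∷ _ , _ with removeLeaf-SIST σ sole (s≤s (s≤s z≤n))
...   | σ′ , restore = inj₁ (_ , σ′ , restore)
decompose σ | [] , _ , _ , ()
decompose σ | (_ ∷ []) , _ , _ , s≤s ()

-- the two constructions never produce the same tree: the maximal node has
-- at least three children in the first, exactly two in the second
addLeaf≢graft : ∀ {n j s s′} i → i < n → SIST n (suc j) s → SIST n j s′ →
                ¬ addLeaf (suc j) s ≡ graft (suc j) i s′
addLeaf≢graft {j = j} {s} {s′} i i< σ σ′@(_ , refl , _) e with maximal-node σ
... | us , sole , _ , two =
  1+n≰n (subst (λ xs → 2 ≤ length xs) (proj₂ (∷-injective (proj₁ (∷-injective same)))) two)
  where
    k = suc j
    added : SoleNode k (addLeaf k s) (leaf ∷ us)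
    added = soleNode-modifyAt k (leaf ∷_) s refl sole
    grafted : SoleNode k (addLeaf k s) cherryKids
    grafted = subst (λ x → SoleNode k x cherryKids) (sym e) (soleNode-graft k i s′ (sist-fresh σ′) i<)
    same : (leaf ∷ us) ∷ [] ≡ cherryKids ∷ []
    same = trans (sym added) grafted

enum : ℕ → ℕ → List STree
enum zero k = []
enum (suc zero) zero = leaf ∷ []
enum (suc zero) (suc k) = []
enum (suc (suc m)) zero = []
enum (suc (suc m)) (suc j) =
  map (addLeaf (suc j)) (enum (suc m) (suc j)) ++ table (graft (suc j)) (suc m) (enum (suc m) j)

enum-sound-step : ∀ m → (∀ k t → t ∈ enum (suc m) k → SIST (suc m) k t) →
                  ∀ j t → t ∈ enum (suc (suc m)) (suc j) → SIST (suc (suc m)) (suc j) t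
enum-sound-step m sound j t t∈ with ∈-++⁻ (map (addLeaf (suc j)) (enum (suc m) (suc j))) t∈
... | inj₁ p with ∈-map⁻ (addLeaf (suc j)) p
...   | s , s∈ , refl = addLeaf-SIST (sound (suc j) s s∈)
enum-sound-step m sound j t t∈ | inj₂ p with ∈-table⁻ (graft (suc j)) (suc m) (enum (suc m) j) p
...   | i , i< , s , s∈ , refl = graft-SIST i i< (sound j s s∈)

enum-complete-step : ∀ m → (∀ k t → SIST (suc m) k t → t ∈ enum (suc m) k) →
                     ∀ j t → SIST (suc (suc m)) (suc j) t → t ∈ enum (suc (suc m)) (suc j)
enum-complete-step m complete j t σ with decompose σ
... | inj₁ (s , σ′ , refl) =
  ∈-++⁺ˡ (∈-map⁺ (addLeaf (suc j)) (complete (suc j) s σ′))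
... | inj₂ (i , i< , s , σ′ , refl) =
  ∈-++⁺ʳ (map (addLeaf (suc j)) (enum (suc m) (suc j)))
         (∈-table⁺ (graft (suc j)) (suc m) (enum (suc m) j) i< (complete j s σ′))

enum-sound : ∀ n k t → t ∈ enum n k → SIST n k t
enum-sound (suc zero) zero t (here refl) = (tt , tt , ↭-refl) , refl , refl
enum-sound (suc (suc m)) (suc j) = enum-sound-step m (enum-sound (suc m)) j

enum-complete : ∀ n k t → SIST n k t → t ∈ enum n k
enum-complete zero k t ((S , _) , lv , _) with subst (1 ≤_) lv (leaves-positive t S)
... | ()
enum-complete (suc zero) k t ((S , _) , lv , _) with single-leaf t S (≤-reflexive lv)
enum-complete (suc zero) zero .leaf _ | refl = here refl
enum-complete (suc zero) (suc k) .leaf (_ , _ , ()) | refl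
enum-complete (suc (suc m)) zero leaf (_ , () , _)
enum-complete (suc (suc m)) zero (node _ _) (_ , _ , ())
enum-complete (suc (suc m)) (suc j) = enum-complete-step m (enum-complete (suc m)) j

-- no tree is listed twice: the two constructions are injective and disjoint
enum-Unique : ∀ n k → Unique (enum n k)
enum-Unique zero k = []
enum-Unique (suc zero) zero = [] ∷ []
enum-Unique (suc zero) (suc k) = []
enum-Unique (suc (suc m)) zero = []
enum-Unique (suc (suc m)) (suc j) =
  Unique.++⁺ (Unique.map⁺ addLeaf-injective (enum-Unique (suc m) (suc j)))
             (table-Unique (graft k) (suc m) (enum (suc m) j) (enum-Unique (suc m) j) graft-injective-on)
             disjoint
  where
    k = suc j
    addLeaf-injective : ∀ {s s′} → addLeaf k s ≡ addLeaf k s′ → s ≡ s′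
    addLeaf-injective {s} {s′} e =
      trans (sym (removeLeaf-addLeaf k s)) (trans (cong (removeLeaf k) e) (removeLeaf-addLeaf k s′))
    graft-injective-on : ∀ {i i′ s s′} → i < suc m → i′ < suc m → s ∈ enum (suc m) j → s′ ∈ enum (suc m) j →
                         graft k i s ≡ graft k i′ s′ → i ≡ i′ × s ≡ s′
    graft-injective-on {i} {i′} {s} {s′} i< i′< s∈ s′∈ =
      graft-jointly-injective k (sist-fresh σ) (sist-fresh (enum-sound (suc m) j s′ s′∈))
        (subst (i <_) (sym (proj₁ (proj₂ σ))) i<) (subst (i′ <_) (sym (proj₁ (proj₂ σ))) i′<)
      where σ = enum-sound (suc m) j s s∈
    disjoint : ∀ {t} → ¬ (t ∈ map (addLeaf k) (enum (suc m) (suc j)) × t ∈ table (graft k) (suc m) (enum (suc m) j))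
    disjoint (p , q) with ∈-map⁻ (addLeaf k) p | ∈-table⁻ (graft k) (suc m) (enum (suc m) j) q
    ... | s , s∈ , e₁ | i , i< , s′ , s′∈ , e₂ =
      addLeaf≢graft i i< (enum-sound (suc m) (suc j) s s∈) (enum-sound (suc m) j s′ s′∈) (trans (sym e₁) e₂)

length-enum-step : ∀ m j →
  length (enum (suc (suc m)) (suc j)) ≡ length (enum (suc m) (suc j)) + suc m * length (enum (suc m) j)
length-enum-step m j =
  trans (length-++ (map (addLeaf (suc j)) (enum (suc m) (suc j))))
        (cong₂ _+_ (length-map (addLeaf (suc j)) (enum (suc m) (suc j)))
                   (length-table (graft (suc j)) (suc m) (enum (suc m) j)))

esym : List ℕ → ℕ → ℕ
esym [] zero = 1
esym [] (suc k) = 0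
esym (ℓ ∷ ls) zero = esym ls zero
esym (ℓ ∷ ls) (suc k) = esym ls (suc k) + ℓ * esym ls k

esym-zero : ∀ ls → esym ls 0 ≡ 1
esym-zero [] = refl
esym-zero (ℓ ∷ ls) = esym-zero ls

esym-snoc : ∀ ls ℓ k → esym (ls ++ ℓ ∷ []) (suc k) ≡ esym ls (suc k) + ℓ * esym ls k
esym-snoc [] ℓ zero = refl
esym-snoc [] ℓ (suc k) = refl
esym-snoc (a ∷ ls) ℓ zero
  rewrite esym-snoc ls ℓ zero | esym-zero (ls ++ ℓ ∷ []) | esym-zero ls =
  solve 3 (λ x l a′ → (x :+ l :* con 1) :+ a′ :* con 1 := (x :+ a′ :* con 1) :+ l :* con 1) refl (esym ls 1) ℓ a
esym-snoc (a ∷ ls) ℓ (suc k) rewrite esym-snoc ls ℓ (suc k) | esym-snoc ls ℓ k =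
  solve 5 (λ x y z l a′ → (x :+ l :* y) :+ a′ :* (y :+ l :* z) := (x :+ a′ :* y) :+ l :* (y :+ a′ :* z)) refl
    (esym ls (suc (suc k))) (esym ls (suc k)) (esym ls k) ℓ a

esym-vanish : ∀ ls k → length ls < k → esym ls k ≡ 0
esym-vanish [] (suc k) _ = refl
esym-vanish (ℓ ∷ ls) (suc k) (s≤s lt) =
  trans (cong₂ (λ x y → x + ℓ * y) (esym-vanish ls (suc k) (m≤n⇒m≤1+n lt)) (esym-vanish ls k lt)) (*-zeroʳ ℓ)

coeff-+ₚ : ∀ p q k → coeff (p +ₚ q) k ≡ coeff p k + coeff q k
coeff-+ₚ [] q k = refl
coeff-+ₚ (a ∷ p) [] zero = sym (+-identityʳ a)
coeff-+ₚ (a ∷ p) [] (suc k) = sym (+-identityʳ _)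
coeff-+ₚ (a ∷ p) (b ∷ q) zero = refl
coeff-+ₚ (a ∷ p) (b ∷ q) (suc k) = coeff-+ₚ p q k

coeff-scale : ∀ a p k → coeff (map (a *_) p) k ≡ a * coeff p k
coeff-scale a [] k = sym (*-zeroʳ a)
coeff-scale a (b ∷ p) zero = refl
coeff-scale a (b ∷ p) (suc k) = coeff-scale a p k

coeff-*ₚ : ∀ a p q k → coeff ((a ∷ p) *ₚ q) k ≡ a * coeff q k + coeff (0 ∷ p *ₚ q) k
coeff-*ₚ a p q k = trans (coeff-+ₚ (map (a *_) q) (0 ∷ p *ₚ q) k) (cong (_+ coeff (0 ∷ p *ₚ q) k) (coeff-scale a q k))

coeff-const*ₚ : ∀ a q k → coeff ((a ∷ []) *ₚ q) k ≡ a * coeff q k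
coeff-const*ₚ a q zero = trans (coeff-*ₚ a [] q zero) (+-identityʳ _)
coeff-const*ₚ a q (suc k) = trans (coeff-*ₚ a [] q (suc k)) (+-identityʳ _)

coeff-onePlus*ₚ : ∀ ℓ q k → coeff (onePlus ℓ *ₚ q) (suc k) ≡ coeff q (suc k) + ℓ * coeff q k
coeff-onePlus*ₚ ℓ q k =
  trans (coeff-*ₚ 1 (ℓ ∷ []) q (suc k)) (cong₂ _+_ (*-identityˡ _) (coeff-const*ₚ ℓ q k))

coeff-prod : ∀ ls k → coeff (prodₚ (map onePlus ls)) k ≡ esym ls k
coeff-prod [] zero = refl
coeff-prod [] (suc k) = refl
coeff-prod (ℓ ∷ ls) zero =
  trans (coeff-*ₚ 1 (ℓ ∷ []) (prodₚ (map onePlus ls)) zero)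
        (trans (+-identityʳ _) (trans (*-identityˡ _) (coeff-prod ls zero)))
coeff-prod (ℓ ∷ ls) (suc k) =
  trans (coeff-onePlus*ₚ ℓ (prodₚ (map onePlus ls)) k)
        (cong₂ (λ x y → x + ℓ * y) (coeff-prod ls (suc k)) (coeff-prod ls k))

coeff-rhs-zero : ∀ n → coeff (rhs n) 0 ≡ 0
coeff-rhs-zero n = coeff-*ₚ 0 (1 ∷ []) (prodₚ (map onePlus (twoTo n))) zero

coeff-rhs-suc : ∀ n k → coeff (rhs n) (suc k) ≡ esym (twoTo n) k
coeff-rhs-suc n k = begin
  coeff (rhs n) (suc k)                      ≡⟨ coeff-*ₚ 0 (1 ∷ []) P (suc k) ⟩
  coeff ((1 ∷ []) *ₚ P) k                    ≡⟨ coeff-const*ₚ 1 P k ⟩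
  1 * coeff P k                              ≡⟨ *-identityˡ _ ⟩
  coeff P k                                  ≡⟨ coeff-prod (twoTo n) k ⟩
  esym (twoTo n) k                           ∎
  where
    open ≡-Reasoning
    P = prodₚ (map onePlus (twoTo n))

twoTo-snoc : ∀ m → twoTo (3 + m) ≡ twoTo (2 + m) ++ (2 + m) ∷ []
twoTo-snoc m = trans (cong (map (2 +_)) (sym (upTo-∷ʳ m))) (map-++ (2 +_) (upTo m) (m ∷ []))

length-twoTo : ∀ n → length (twoTo n) ≡ n ∸ 2
length-twoTo n = trans (length-map (2 +_) (upTo (n ∸ 2))) (length-upTo (n ∸ 2))

rhs-degree : ∀ n k → suc (n ∸ 2) < k → coeff (rhs n) k ≡ 0
rhs-degree n (suc k) (s≤s n-2<k) =
  trans (coeff-rhs-suc n k) (esym-vanish (twoTo n) k (subst (_< k) (sym (length-twoTo n)) n-2<k))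

length-enum : ∀ m j → length (enum (2 + m) (suc j)) ≡ esym (twoTo (2 + m)) j
length-enum zero zero = refl
length-enum zero (suc j) = refl
length-enum (suc m) zero = begin
  length (enum (3 + m) 1)                            ≡⟨ length-enum-step (suc m) zero ⟩
  length (enum (2 + m) 1) + (2 + m) * 0              ≡⟨ cong₂ _+_ (length-enum m zero) (*-zeroʳ (2 + m)) ⟩
  esym (twoTo (2 + m)) 0 + 0                         ≡⟨ cong (_+ 0) (esym-zero (twoTo (2 + m))) ⟩
  1                                                  ≡⟨ sym (esym-zero (twoTo (3 + m))) ⟩
  esym (twoTo (3 + m)) 0                             ∎
  where open ≡-Reasoning
length-enum (suc m) (suc j) = begin
  length (enum (3 + m) (2 + j))                                ≡⟨ length-enum-step (suc m) (suc j) ⟩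
  length (enum (2 + m) (2 + j)) + (2 + m) * length (enum (2 + m) (1 + j))
    ≡⟨ cong₂ (λ x y → x + (2 + m) * y) (length-enum m (suc j)) (length-enum m j) ⟩
  esym L (suc j) + (2 + m) * esym L j                          ≡⟨ sym (esym-snoc L (2 + m) j) ⟩
  esym (L ++ (2 + m) ∷ []) (suc j)                             ≡⟨ cong (λ ls → esym ls (suc j)) (sym (twoTo-snoc m)) ⟩
  esym (twoTo (3 + m)) (suc j)                                 ∎
  where
    open ≡-Reasoning
    L = twoTo (2 + m)

length-enum-rhs : ∀ m k → length (enum (2 + m) k) ≡ coeff (rhs (2 + m)) k
length-enum-rhs m zero = sym (coeff-rhs-zero (2 + m))
length-enum-rhs m (suc j) = trans (length-enum m j) (sym (coeff-rhs-suc (2 + m) j))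

corollary1 : (n : ℕ) → 2 ≤ n →
    ((k : ℕ) → k < n → HasCount (SIST n k) (coeff (rhs n) k))
    × ((k : ℕ) → n ≤ k → coeff (rhs n) k ≡ 0)
corollary1 (suc zero) (s≤s ())
corollary1 (suc (suc m)) _ = counted , rhs-degree (suc (suc m))
  where
    counted : (k : ℕ) → k < suc (suc m) → HasCount (SIST (suc (suc m)) k) (coeff (rhs (suc (suc m))) k)
    counted k _ =
      enum (2 + m) k ,
      enum-Unique (2 + m) k ,
      (λ t → mk⇔ (enum-sound (2 + m) k t) (enum-complete (2 + m) k t)) ,
      length-enum-rhs m k
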